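{- Let $G$ be a signed graph, let $u_1\neq u_2$ and $w_1\neq w_2$ be vertices, and let $e$ be the edge between $w_1$ and $w_2$ (an edge $e$ joining $w_1,w_2$ added to $G$ if none exists). Adding $e$ to any Tutte-$2$-arborescence for $[u_1u_2,w_1w_2]$, or to any contributor-$2$-arborescence associated to an element of $\widehat{\mathfrak{C}}^1_{\neq0}(L^0(G);u_1u_2,w_1w_2)$, produces a spanning tree of $G\cup e$.
   Context: An oriented hypergraph consists of vertices $V$, edges $E$, incidences $I$ with maps $\varsigma:I\to V$, $\omega:I\to E$ and $\sigma:I\to\{\pm1\}$; an adjacency is an ordered pair of distinct incidences on one edge, from the vertex of the first to the vertex of the second; a backstep at $v$ is the step using a single incidence $i$ at $v$ twice. A signed graph is one in which each edge has exactly two incidences. A Tutte-$2$-arborescence for $[u_1u_2,w_1w_2]$ is a spanning forest of the underlying graph with exactly two components, one containing $u_1$, the other $u_2$, with either $u_1,w_1$ in one component and $u_2,w_2$ in the other, or $u_1,w_2$ in one and $u_2,w_1$ in the other. $\widehat{\mathfrak{C}}_{\neq0}(L^0(G);u_1u_2,w_1w_2)$ is the set of assignments $c$ choosing for each $v\in V\setminus\{u_1,u_2\}$ an adjacency of $G$ from $v$ or a backstep at $v$ such that $\pi_c(v)=$ head of the step at $v$ ($v\notin\{u_1,u_2\}$), $\pi_c(u_i)=w_i$, is a bijection of $V$. Two such $c$ are tail-equivalent if at each $v\notin\{u_1,u_2\}$ their steps use the same tail incidence; $\widehat{\mathfrak{C}}^1_{\neq0}$ is the set of elements whose tail-equivalence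 class is a singleton. The contributor-$2$-arborescence associated to such $c$ is the spanning subgraph of $G$ whose edges are the edges used by the steps of $c$ (each backstep "unpacked" into the edge of its incidence). -}

module Defs where

open import Data.Nat using (ℕ; suc)
open import Data.Fin using (Fin; zero; suc; _≟_)
open import Data.Bool using (Bool; true; false; if_then_else_)
open import Data.Sign using (Sign)
open import Data.Product using (Σ; ∃; _×_; _,_)
open import Data.Sum using (_⊎_)
open import Data.Unit using (⊤)
open import Data.List using (List; []; _∷_)
open import Data.List.Relation.Unary.Unique.Propositional using (Unique)
open import Relation.Nullary using (¬_; yes; no)
open import Relation.Binary.PropositionalEquality using (_≡_; _≢_)
open import Function.Definitions using (Bijective)

-- Every edge e has exactly
-- two incidences (e , zero) and (e , suc zero); incidence (e , i) is at vertex
-- ends e i (ς) with sign sgn e i (σ).  ω (e , i) = e.  Loops (both incidences at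
-- one vertex) and parallel edges are allowed.
record SignedGraph (n m : ℕ) : Set where
  field
    ends : Fin m → Fin 2 → Fin n
    sgn  : Fin m → Fin 2 → Sign
open SignedGraph public

other : Fin 2 → Fin 2
other zero = suc zero
other (suc _) = zero

module _ {n m : ℕ} (G : SignedGraph n m) where

  EdgeSet : Set₁
  EdgeSet = Fin m → Set

  data Walk (S : EdgeSet) : Fin n → Fin n → Set where
    []  : ∀ {x} → Walk S x x
    step : ∀ {x y} (e : Fin m) → S e → (i : Fin 2) → ends G e i ≡ x →
           Walk S (ends G e (other i)) y → Walk S x y

  walkEdges : ∀ {S x y} → Walk S x y → List (Fin m)
  walkEdges [] = []
  walkEdges (step e _ _ _ w) = e ∷ walkEdges w

  walkTails : ∀ {S x y} → Walk S x y → List (Fin n)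
  walkTails [] = []
  walkTails {x = x} (step _ _ _ _ w) = x ∷ walkTails w

  Connected : EdgeSet → Fin n → Fin n → Set
  Connected S x y = Walk S x y

  -- a cycle: a nonempty closed walk with pairwise distinct edges and
  -- pairwise distinct vertices (a loop is a cycle of length 1, two parallel
  -- edges form a cycle of length 2)
  record Cycle (S : EdgeSet) : Set where
    field
      base     : Fin n
      walk     : Walk S base base
      nonempty : walkEdges walk ≢ []
      uniqE    : Unique (walkEdges walk)
      uniqV    : Unique (walkTails walk)

  Forest : EdgeSet → Set
  Forest S = ¬ Cycle S

  SpanningTree : EdgeSet → Set
  SpanningTree S = Forest S × (∀ x y → Connected S x y)

  Joins : Fin m → Fin n → Fin n → Set
  Joins e w₁ w₂ = (ends G e zero ≡ w₁ × ends G e (suc zero) ≡ w₂)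
                ⊎ (ends G e zero ≡ w₂ × ends G e (suc zero) ≡ w₁)

  Tutte2Arb : Fin n → Fin n → Fin n → Fin n → EdgeSet → Set
  Tutte2Arb u₁ u₂ w₁ w₂ S =
    Forest S
    × ¬ Connected S u₁ u₂
    × (∀ x → Connected S u₁ x ⊎ Connected S u₂ x)
    × ((Connected S u₁ w₁ × Connected S u₂ w₂)
       ⊎ (Connected S u₁ w₂ × Connected S u₂ w₁))

  -- a step: tail incidence (edge , side), and whether it is a backstep
  -- (back = true) or the adjacency from (edge , side) to (edge , other side)
  record Step : Set where
    constructor mkStep
    field
      edge : Fin m
      side : Fin 2
      back : Bool
  open Step public

  stepTail : Step → Fin n
  stepTail s = ends G (edge s) (side s)

  stepHead : Step → Fin n
  stepHead s = if back s then stepTail s else ends G (edge s) (other (side s))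

  -- an assignment of steps; only its values at v ∉ {u₁,u₂} are meaningful
  Assignment : Set
  Assignment = Fin n → Step

  Free : Fin n → Fin n → Fin n → Set
  Free u₁ u₂ v = v ≢ u₁ × v ≢ u₂

  πc : Fin n → Fin n → Fin n → Fin n → Assignment → Fin n → Fin n
  πc u₁ u₂ w₁ w₂ c v with v ≟ u₁
  ... | yes _ = w₁
  ... | no _ with v ≟ u₂
  ...   | yes _ = w₂
  ...   | no _  = stepHead (c v)

  InC : Fin n → Fin n → Fin n → Fin n → Assignment → Set
  InC u₁ u₂ w₁ w₂ c =
    (∀ v → Free u₁ u₂ v → stepTail (c v) ≡ v)
    × Bijective _≡_ _≡_ (πc u₁ u₂ w₁ w₂ c)

  TailEq : Fin n → Fin n → Assignment → Assignment → Set
  TailEq u₁ u₂ c c' = ∀ v → Free u₁ u₂ v →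
    (edge (c v) ≡ edge (c' v)) × (side (c v) ≡ side (c' v))

  SameAssignment : Fin n → Fin n → Assignment → Assignment → Set
  SameAssignment u₁ u₂ c c' = ∀ v → Free u₁ u₂ v → c v ≡ c' v

  -- c ∈ Ĉ¹_{≠0}: its tail-equivalence class (within Ĉ_{≠0}) is a singleton
  InC1 : Fin n → Fin n → Fin n → Fin n → Assignment → Set
  InC1 u₁ u₂ w₁ w₂ c =
    InC u₁ u₂ w₁ w₂ c
    × (∀ c' → InC u₁ u₂ w₁ w₂ c' → TailEq u₁ u₂ c c' → SameAssignment u₁ u₂ c c')

  ContribArb : Fin n → Fin n → Assignment → EdgeSet
  ContribArb u₁ u₂ c f = Σ (Fin n) λ v → Free u₁ u₂ v × edge (c v) ≡ f

addEdge : ∀ {m} → (Fin m → Set) → Fin m → (Fin m → Set)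
addEdge S e f = S f ⊎ f ≡ e

extend : ∀ {n m} → SignedGraph n m → Fin n → Fin n → Sign → Sign → SignedGraph n (suc m)
ends (extend G w₁ w₂ s₁ s₂) zero zero = w₁
ends (extend G w₁ w₂ s₁ s₂) zero (suc _) = w₂
ends (extend G w₁ w₂ s₁ s₂) (suc f) i = ends G f i
sgn (extend G w₁ w₂ s₁ s₂) zero zero = s₁
sgn (extend G w₁ w₂ s₁ s₂) zero (suc _) = s₂
sgn (extend G w₁ w₂ s₁ s₂) (suc f) i = sgn G f i

addNewEdge : ∀ {m} → (Fin m → Set) → (Fin (suc m) → Set)
addNewEdge S zero = ⊤
addNewEdge S (suc f) = S f

-- Both kinds of arborescence are spanning forests with exactly two trees, one containing w₁
-- and the other w₂; adding an edge joining w₁ and w₂ to such a forest gives a spanning tree.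
-- This is immediate for a Tutte-2-arborescence. For a contributor c, every v ∉ {u₁, u₂}
-- points along its step to a parent. Were there a cycle of parents, switching backsteps and
-- adjacencies along all such cycles would give a second bijection with the same tails, so for
-- c ∈ Ĉ¹ the parent edges form a forest rooted at u₁ and u₂. Finally, if w₁ and w₂ lay in one
-- tree, pulling the other root back along π⁻¹ would stay inside its own tree forever, which
-- again produces a cycle of parents.

module Submission where

open import Defs
open import Data.Bool using (true; false; not)
open import Data.Bool.Properties using (not-¬)
open import Data.Empty using (⊥; ⊥-elim)
open import Data.Fin using (Fin; zero; suc; toℕ; fromℕ<; punchOut; _≟_)
open import Data.Fin.Properties using (pigeonhole; toℕ<n; toℕ-fromℕ<; any?; punchOut-injective; injective⇒≤)
open import Data.List using (List; []; _∷_; _++_; map; reverse)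
open import Data.List.Properties using (unfold-reverse)
open import Data.List.Membership.Propositional using (_∈_; _∉_)
open import Data.List.Relation.Unary.Any using (here; there) renaming (any? to anyᴸ?)
open import Data.List.Relation.Unary.Any.Properties using (reverse⁻)
open import Data.List.Relation.Unary.Unique.Propositional using (Unique)
open import Data.List.Relation.Unary.Unique.Propositional.Properties using (map⁻; Unique[x∷xs]⇒x∉xs)
open import Data.List.Relation.Unary.AllPairs using (_∷_)
open import Data.List.Relation.Binary.Permutation.Propositional using (↭⇒↭ₛ; ↭-sym)
open import Data.List.Relation.Binary.Permutation.Propositional.Properties using (↭-reverse)
open import Data.List.Relation.Binary.Permutation.Setoid.Properties using (Unique-resp-↭)
open import Data.Nat using (ℕ; zero; suc; _+_; _*_; _∸_; _≤_; _<_)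
open import Data.Nat.GeneralisedArithmetic using (iterate)
open import Data.Nat.Properties using (≤-refl; ≤-trans; <⇒≤pred; n<1+n; +-suc; +-comm; *-comm; m≤n⇒∃[o]m+o≡n; m+[n∸m]≡n; 1+n≰n; m≤n+m; module ≤-Reasoning)
open import Data.Product using (Σ-syntax; ∃₂; _×_; _,_; proj₁; proj₂)
open import Data.Sign using (Sign)
open import Data.Sum using (_⊎_; inj₁; inj₂)
import Data.Sum as Sum
open import Data.Unit using (tt)
open import Function using (_∘_)
open import Function.Definitions using (Injective; Surjective)
open import Relation.Nullary using (¬_; yes; no; contradiction)
open import Relation.Nullary.Decidable using (_×-dec_; ¬?)
open import Relation.Unary using (Decidable; _⊆_; _≐_)
open import Relation.Binary.PropositionalEquality

other-involutive : ∀ i → other (other i) ≡ i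
other-involutive zero = refl
other-involutive (suc zero) = refl

≡-or-≡-other : (i j : Fin 2) → i ≡ j ⊎ i ≡ other j
≡-or-≡-other zero zero = inj₁ refl
≡-or-≡-other zero (suc zero) = inj₂ refl
≡-or-≡-other (suc zero) zero = inj₂ refl
≡-or-≡-other (suc zero) (suc zero) = inj₁ refl

reverse-unique : ∀ {A : Set} {xs : List A} → Unique xs → Unique (reverse xs)
reverse-unique {A} {xs} = Unique-resp-↭ (setoid A) (↭⇒↭ₛ (↭-sym (↭-reverse xs)))

injective⇒surjective : ∀ {n} {f : Fin n → Fin n} → Injective _≡_ _≡_ f → Surjective _≡_ _≡_ f
injective⇒surjective {suc n} {f} f-inj y with any? (λ x → f x ≟ y)
... | yes (x , fx≡y) = x , λ { refl → fx≡y }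
... | no ∄x = contradiction (injective⇒≤ punched-inj) 1+n≰n
  where
  y≢f : ∀ x → y ≢ f x
  y≢f x y≡fx = ∄x (x , sym y≡fx)
  punched : Fin (suc n) → Fin n
  punched x = punchOut (y≢f x)
  punched-inj : Injective _≡_ _≡_ punched
  punched-inj {x} {x'} eq = f-inj (punchOut-injective (y≢f x) (y≢f x') eq)

sequence-repeats : ∀ {n} (s : ℕ → Fin n) → ∃₂ λ i d → i + suc d ≤ n × s i ≡ s (i + suc d)
sequence-repeats {n} s with pigeonhole (n<1+n n) (s ∘ toℕ)
... | i , j , i<j , sᵢ≡sⱼ with m≤n⇒∃[o]m+o≡n i<j
... | d , i+1+d≡j = toℕ i , d , subst (_≤ n) (sym i+suc-d≡j) (<⇒≤pred (toℕ<n j))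
                  , subst (λ k → s (toℕ i) ≡ s k) (sym i+suc-d≡j) sᵢ≡sⱼ
  where
  i+suc-d≡j : toℕ i + suc d ≡ toℕ j
  i+suc-d≡j = trans (+-suc (toℕ i) d) i+1+d≡j

module _ {A : Set} (f : A → A) where

  iterate-+ : ∀ x a b → iterate f x (a + b) ≡ iterate f (iterate f x a) b
  iterate-+ x zero b = refl
  iterate-+ x (suc a) b = iterate-+ (f x) a b

  iterate-sucʳ : ∀ x k → iterate f x (suc k) ≡ f (iterate f x k)
  iterate-sucʳ x k = trans (cong (iterate f x) (+-comm 1 k)) (iterate-+ x k 1)

  iterate-fixed : ∀ {x} → f x ≡ x → ∀ k → iterate f x k ≡ x
  iterate-fixed fx≡x zero = refl
  iterate-fixed fx≡x (suc k) rewrite fx≡x = iterate-fixed fx≡x k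

  iterate-multiple : ∀ {x p} → iterate f x p ≡ x → ∀ k → iterate f x (k * p) ≡ x
  iterate-multiple per zero = refl
  iterate-multiple {x} {p} per (suc k) = begin
    iterate f x (p + k * p)         ≡⟨ iterate-+ x p (k * p) ⟩
    iterate f (iterate f x p) (k * p) ≡⟨ cong (λ y → iterate f y (k * p)) per ⟩
    iterate f x (k * p)             ≡⟨ iterate-multiple per k ⟩
    x                               ∎
    where open ≡-Reasoning

module _ {n m} {G : SignedGraph n m} where

  infixr 5 _++ʷ_
  _++ʷ_ : ∀ {S x y z} → Walk G S x y → Walk G S y z → Walk G S x z
  [] ++ʷ V = V
  step e s i eq W ++ʷ V = step e s i eq (W ++ʷ V)

  edges-++ʷ : ∀ {S x y z} (W : Walk G S x y) (V : Walk G S y z) →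
    walkEdges G (W ++ʷ V) ≡ walkEdges G W ++ walkEdges G V
  edges-++ʷ [] V = refl
  edges-++ʷ (step e s i eq W) V = cong (e ∷_) (edges-++ʷ W V)

  backStep : ∀ {S x} e → S e → (i : Fin 2) → ends G e i ≡ x → Walk G S (ends G e (other i)) x
  backStep e s zero refl = step e s (suc zero) refl []
  backStep e s (suc zero) refl = step e s zero refl []

  edges-backStep : ∀ {S x} e (s : S e) i (eq : ends G e i ≡ x) → walkEdges G (backStep {S = S} e s i eq) ≡ e ∷ []
  edges-backStep e s zero refl = refl
  edges-backStep e s (suc zero) refl = refl

  reverseʷ : ∀ {S x y} → Walk G S x y → Walk G S y x
  reverseʷ [] = []
  reverseʷ {S} (step e s i eq W) = reverseʷ W ++ʷ backStep {S = S} e s i eq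

  edges-reverseʷ : ∀ {S x y} (W : Walk G S x y) → walkEdges G (reverseʷ W) ≡ reverse (walkEdges G W)
  edges-reverseʷ [] = refl
  edges-reverseʷ {S} {x} (step e s i eq W) = begin
    walkEdges G (reverseʷ W ++ʷ final)                 ≡⟨ edges-++ʷ (reverseʷ W) final ⟩
    walkEdges G (reverseʷ W) ++ walkEdges G final      ≡⟨ cong₂ _++_ (edges-reverseʷ W) (edges-backStep {S = S} e s i eq) ⟩
    reverse (walkEdges G W) ++ e ∷ []                  ≡⟨ sym (unfold-reverse e (walkEdges G W)) ⟩
    reverse (e ∷ walkEdges G W)                        ∎
    where
    open ≡-Reasoning
    final : Walk G S (ends G e (other i)) x
    final = backStep e s i eq

  mapʷ : ∀ {S S' x y} → S ⊆ S' → Walk G S x y → Walk G S' x y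
  mapʷ S⊆S' [] = []
  mapʷ S⊆S' (step e s i eq W) = step e (S⊆S' s) i eq (mapʷ S⊆S' W)

  edges-mapʷ : ∀ {S S' x y} (S⊆S' : S ⊆ S') (W : Walk G S x y) → walkEdges G (mapʷ S⊆S' W) ≡ walkEdges G W
  edges-mapʷ S⊆S' [] = refl
  edges-mapʷ S⊆S' (step e s i eq W) = cong (e ∷_) (edges-mapʷ S⊆S' W)

  tails-mapʷ : ∀ {S S' x y} (S⊆S' : S ⊆ S') (W : Walk G S x y) → walkTails G (mapʷ S⊆S' W) ≡ walkTails G W
  tails-mapʷ S⊆S' [] = refl
  tails-mapʷ {x = x} S⊆S' (step e s i eq W) = cong (x ∷_) (tails-mapʷ S⊆S' W)

  cycleAlong : ∀ {S S'} (C : Cycle G S) (W : Walk G S' (Cycle.base C) (Cycle.base C)) →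
    walkEdges G W ≡ walkEdges G (Cycle.walk C) → walkTails G W ≡ walkTails G (Cycle.walk C) → Cycle G S'
  cycleAlong C W same-edges same-tails = record
    { base = Cycle.base C
    ; walk = W
    ; nonempty = Cycle.nonempty C ∘ trans (sym same-edges)
    ; uniqE = subst Unique (sym same-edges) (Cycle.uniqE C)
    ; uniqV = subst Unique (sym same-tails) (Cycle.uniqV C)
    }

  Forest-antitone : ∀ {S S'} → S ⊆ S' → Forest G S' → Forest G S
  Forest-antitone S⊆S' forest C = forest (cycleAlong C (mapʷ S⊆S' (Cycle.walk C)) (edges-mapʷ S⊆S' _) (tails-mapʷ S⊆S' _))

  SpanningTree-resp-≐ : ∀ {S S'} → S ≐ S' → SpanningTree G S → SpanningTree G S'
  SpanningTree-resp-≐ (S⊆S' , S'⊆S) (forest , connected) =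
    Forest-antitone S'⊆S forest , λ x y → mapʷ S⊆S' (connected x y)

-- Spanning 2-forests

record Spanning2Forest {n m} (G : SignedGraph n m) (T : EdgeSet G) (w₁ w₂ : Fin n) : Set where
  field
    forest    : Forest G T
    separated : ¬ Connected G T w₁ w₂
    covering  : ∀ x → Connected G T w₁ x ⊎ Connected G T w₂ x

module _ {n m} {G : SignedGraph n m} {T : EdgeSet G} {e : Fin m} where

  avoiding : ∀ {x y} (W : Walk G (addEdge T e) x y) → e ∉ walkEdges G W → Walk G T x y
  avoiding [] _ = []
  avoiding (step f (inj₁ s) i eq W) e∉ = step f s i eq (avoiding W (e∉ ∘ there))
  avoiding (step f (inj₂ f≡e) i eq W) e∉ = ⊥-elim (e∉ (here (sym f≡e)))

  edges-avoiding : ∀ {x y} (W : Walk G (addEdge T e) x y) (e∉ : e ∉ walkEdges G W) →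
    walkEdges G (avoiding W e∉) ≡ walkEdges G W
  edges-avoiding [] _ = refl
  edges-avoiding (step f (inj₁ s) i eq W) e∉ = cong (f ∷_) (edges-avoiding W (e∉ ∘ there))
  edges-avoiding (step f (inj₂ f≡e) i eq W) e∉ = ⊥-elim (e∉ (here (sym f≡e)))

  tails-avoiding : ∀ {x y} (W : Walk G (addEdge T e) x y) (e∉ : e ∉ walkEdges G W) →
    walkTails G (avoiding W e∉) ≡ walkTails G W
  tails-avoiding [] _ = refl
  tails-avoiding {x} (step f (inj₁ s) i eq W) e∉ = cong (x ∷_) (tails-avoiding W (e∉ ∘ there))
  tails-avoiding (step f (inj₂ f≡e) i eq W) e∉ = ⊥-elim (e∉ (here (sym f≡e)))

  splitAt : ∀ {x y} (W : Walk G (addEdge T e) x y) → e ∈ walkEdges G W → Unique (walkEdges G W) →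
    Σ[ i ∈ Fin 2 ] Walk G T x (ends G e i) × Walk G T (ends G e (other i)) y
  splitAt (step f s i eq W) e∈ unique with f ≟ e
  splitAt (step f s i refl W) e∈ unique | yes refl = i , [] , avoiding W (Unique[x∷xs]⇒x∉xs unique)
  splitAt (step f (inj₂ f≡e) i eq W) e∈ unique | no f≢e = ⊥-elim (f≢e f≡e)
  splitAt (step f (inj₁ s) i eq W) (here e≡f) unique | no f≢e = ⊥-elim (f≢e (sym e≡f))
  splitAt (step f (inj₁ s) i eq W) (there e∈) (_ ∷ unique) | no f≢e with splitAt W e∈ unique
  ... | j , before , after = j , step f s i eq before , after

  module _ {w₁ w₂ : Fin n} where

    joined-ends-connect : Joins G e w₁ w₂ → ∀ i → Walk G T (ends G e (other i)) (ends G e i) → Walk G T w₁ w₂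
    joined-ends-connect (inj₁ (refl , refl)) zero W = reverseʷ W
    joined-ends-connect (inj₁ (refl , refl)) (suc zero) W = W
    joined-ends-connect (inj₂ (refl , refl)) zero W = W
    joined-ends-connect (inj₂ (refl , refl)) (suc zero) W = reverseʷ W

    joining-walk : Joins G e w₁ w₂ → Walk G (addEdge T e) w₁ w₂
    joining-walk (inj₁ (refl , refl)) = step e (inj₂ refl) zero refl []
    joining-walk (inj₂ (refl , refl)) = step e (inj₂ refl) (suc zero) refl []

    -- A cycle through e leaves, after deleting e, a path of T between the ends of e.
    addEdge-spanningTree : Joins G e w₁ w₂ → Spanning2Forest G T w₁ w₂ → SpanningTree G (addEdge T e)
    addEdge-spanningTree joins F = forest , λ x y → to-w₁ x ++ʷ reverseʷ (to-w₁ y)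
      where
      open Spanning2Forest F renaming (forest to T-forest)

      forest : Forest G (addEdge T e)
      forest C with anyᴸ? (e ≟_) (walkEdges G (Cycle.walk C))
      ... | no e∉ = T-forest (cycleAlong C (avoiding _ e∉) (edges-avoiding _ e∉) (tails-avoiding _ e∉))
      ... | yes e∈ with splitAt (Cycle.walk C) e∈ (Cycle.uniqE C)
      ... | i , before , after = separated (joined-ends-connect joins i (after ++ʷ before))

      to-w₁ : ∀ x → Walk G (addEdge T e) x w₁
      to-w₁ x with covering x
      ... | inj₁ W = reverseʷ (mapʷ inj₁ W)
      ... | inj₂ W = reverseʷ (mapʷ inj₁ W) ++ʷ reverseʷ (joining-walk joins)

module _ {n m} {G : SignedGraph n m} {u₁ u₂ w₁ w₂ : Fin n} {S : EdgeSet G} where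

  tutte2Arb⇒spanning2Forest : Tutte2Arb G u₁ u₂ w₁ w₂ S → Spanning2Forest G S w₁ w₂
  tutte2Arb⇒spanning2Forest (forest , u₁≁u₂ , components , pairing) = record
    { forest = forest
    ; separated = separated pairing
    ; covering = λ x → covering pairing (components x)
    }
    where
    Pairing : Set
    Pairing = (Connected G S u₁ w₁ × Connected G S u₂ w₂) ⊎ (Connected G S u₁ w₂ × Connected G S u₂ w₁)

    separated : Pairing → ¬ Connected G S w₁ w₂
    separated (inj₁ (u₁w₁ , u₂w₂)) W = u₁≁u₂ (u₁w₁ ++ʷ W ++ʷ reverseʷ u₂w₂)
    separated (inj₂ (u₁w₂ , u₂w₁)) W = u₁≁u₂ (u₁w₂ ++ʷ reverseʷ W ++ʷ reverseʷ u₂w₁)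

    covering : ∀ {x} → Pairing → Connected G S u₁ x ⊎ Connected G S u₂ x → Connected G S w₁ x ⊎ Connected G S w₂ x
    covering (inj₁ (u₁w₁ , _)) (inj₁ P) = inj₁ (reverseʷ u₁w₁ ++ʷ P)
    covering (inj₂ (u₁w₂ , _)) (inj₁ P) = inj₂ (reverseʷ u₁w₂ ++ʷ P)
    covering (inj₁ (_ , u₂w₂)) (inj₂ P) = inj₂ (reverseʷ u₂w₂ ++ʷ P)
    covering (inj₂ (_ , u₂w₁)) (inj₂ P) = inj₁ (reverseʷ u₂w₁ ++ʷ P)

oldEdges : ∀ {m} → (Fin m → Set) → (Fin (suc m) → Set)
oldEdges T zero = ⊥
oldEdges T (suc f) = T f

module _ {n m} {G : SignedGraph n m} {w₁ w₂ : Fin n} {s₁ s₂ : Sign} {T : EdgeSet G} where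

  private
    G⁺ : SignedGraph n (suc m)
    G⁺ = extend G w₁ w₂ s₁ s₂

  liftʷ : ∀ {x y} → Walk G T x y → Walk G⁺ (oldEdges T) x y
  liftʷ [] = []
  liftʷ (step e s i eq W) = step (suc e) s i eq (liftʷ W)

  lowerʷ : ∀ {x y} → Walk G⁺ (oldEdges T) x y → Walk G T x y
  lowerʷ [] = []
  lowerʷ (step (suc e) s i eq W) = step e s i eq (lowerʷ W)

  edges-lowerʷ : ∀ {x y} (W : Walk G⁺ (oldEdges T) x y) → walkEdges G⁺ W ≡ map suc (walkEdges G (lowerʷ W))
  edges-lowerʷ [] = refl
  edges-lowerʷ (step (suc e) s i eq W) = cong (suc e ∷_) (edges-lowerʷ W)

  tails-lowerʷ : ∀ {x y} (W : Walk G⁺ (oldEdges T) x y) → walkTails G⁺ W ≡ walkTails G (lowerʷ W)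
  tails-lowerʷ [] = refl
  tails-lowerʷ {x} (step (suc e) s i eq W) = cong (x ∷_) (tails-lowerʷ W)

  lift-spanning2Forest : Spanning2Forest G T w₁ w₂ → Spanning2Forest G⁺ (oldEdges T) w₁ w₂
  lift-spanning2Forest F = record
    { forest = λ C → let W = Cycle.walk C in forest record
        { base = Cycle.base C
        ; walk = lowerʷ W
        ; nonempty = λ empty → Cycle.nonempty C (trans (edges-lowerʷ W) (cong (map suc) empty))
        ; uniqE = map⁻ (subst Unique (edges-lowerʷ W) (Cycle.uniqE C))
        ; uniqV = subst Unique (tails-lowerʷ W) (Cycle.uniqV C)
        }
    ; separated = separated ∘ lowerʷ
    ; covering = Sum.map liftʷ liftʷ ∘ covering
    }
    where open Spanning2Forest F

  addNewEdge-spanningTree : Spanning2Forest G T w₁ w₂ → SpanningTree G⁺ (addNewEdge T)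
  addNewEdge-spanningTree F =
    SpanningTree-resp-≐ (addEdge⊆addNewEdge , addNewEdge⊆addEdge)
      (addEdge-spanningTree (inj₁ (refl , refl)) (lift-spanning2Forest F))
    where
    addEdge⊆addNewEdge : addEdge (oldEdges T) zero ⊆ addNewEdge T
    addEdge⊆addNewEdge {zero} _ = tt
    addEdge⊆addNewEdge {suc f} (inj₁ s) = s

    addNewEdge⊆addEdge : addNewEdge T ⊆ addEdge (oldEdges T) zero
    addNewEdge⊆addEdge {zero} _ = inj₂ refl
    addNewEdge⊆addEdge {suc f} s = inj₁ s

module _ {n m} {G : SignedGraph n m} where

  stepHead-backstep : (s : Step G) → back s ≡ true → stepHead G s ≡ stepTail G s
  stepHead-backstep (mkStep _ _ true) refl = refl

  stepHead-adjacency : (s : Step G) → back s ≡ false → stepHead G s ≡ ends G (edge s) (other (side s))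
  stepHead-adjacency (mkStep _ _ false) refl = refl

  module _ {u₁ u₂ w₁ w₂ : Fin n} where

    πc-local : ∀ {d d' : Assignment G} v → d v ≡ d' v → πc G u₁ u₂ w₁ w₂ d v ≡ πc G u₁ u₂ w₁ w₂ d' v
    πc-local v dv≡d'v with v ≟ u₁
    ... | yes _ = refl
    ... | no _ with v ≟ u₂
    ...   | yes _ = refl
    ...   | no _ = cong (stepHead G) dv≡d'v

    πc-free : ∀ (d : Assignment G) {v} → Free G u₁ u₂ v → πc G u₁ u₂ w₁ w₂ d v ≡ stepHead G (d v)
    πc-free d {v} (v≢u₁ , v≢u₂) with v ≟ u₁
    ... | yes v≡u₁ = contradiction v≡u₁ v≢u₁
    ... | no _ with v ≟ u₂
    ...   | yes v≡u₂ = contradiction v≡u₂ v≢u₂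
    ...   | no _ = refl

    πc-u₁ : ∀ (d : Assignment G) → πc G u₁ u₂ w₁ w₂ d u₁ ≡ w₁
    πc-u₁ d with u₁ ≟ u₁
    ... | yes _ = refl
    ... | no u₁≢u₁ = contradiction refl u₁≢u₁

    πc-u₂ : u₁ ≢ u₂ → ∀ (d : Assignment G) → πc G u₁ u₂ w₁ w₂ d u₂ ≡ w₂
    πc-u₂ u₁≢u₂ d with u₂ ≟ u₁
    ... | yes u₂≡u₁ = contradiction (sym u₂≡u₁) u₁≢u₂
    ... | no _ with u₂ ≟ u₂
    ...   | yes _ = refl
    ...   | no u₂≢u₂ = contradiction refl u₂≢u₂

-- Parent edges of an assignment

module ParentForest {n m} (G : SignedGraph n m) (u₁ u₂ : Fin n) (c : Assignment G)
  (tail≡ : ∀ v → Free G u₁ u₂ v → stepTail G (c v) ≡ v) where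

  IsRoot : Fin n → Set
  IsRoot v = v ≡ u₁ ⊎ v ≡ u₂

  NonRoot : Fin n → Set
  NonRoot = Free G u₁ u₂

  nonRoot-or-root : ∀ v → NonRoot v ⊎ IsRoot v
  nonRoot-or-root v with v ≟ u₁ | v ≟ u₂
  ... | yes v≡u₁ | _ = inj₂ (inj₁ v≡u₁)
  ... | no _ | yes v≡u₂ = inj₂ (inj₂ v≡u₂)
  ... | no v≢u₁ | no v≢u₂ = inj₁ (v≢u₁ , v≢u₂)

  nonRoot⇒¬root : ∀ {v} → NonRoot v → ¬ IsRoot v
  nonRoot⇒¬root (v≢u₁ , _) (inj₁ v≡u₁) = v≢u₁ v≡u₁
  nonRoot⇒¬root (_ , v≢u₂) (inj₂ v≡u₂) = v≢u₂ v≡u₂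

  ¬root⇒nonRoot : ∀ {v} → ¬ IsRoot v → NonRoot v
  ¬root⇒nonRoot {v} v-¬root with nonRoot-or-root v
  ... | inj₁ v-nr = v-nr
  ... | inj₂ v-root = contradiction v-root v-¬root

  root-is-one-of : ∀ {a b d} → IsRoot a → IsRoot b → IsRoot d → b ≢ d → a ≡ b ⊎ a ≡ d
  root-is-one-of (inj₁ refl) (inj₁ refl) _ _ = inj₁ refl
  root-is-one-of (inj₁ refl) _ (inj₁ refl) _ = inj₂ refl
  root-is-one-of (inj₂ refl) (inj₂ refl) _ _ = inj₁ refl
  root-is-one-of (inj₂ refl) _ (inj₂ refl) _ = inj₂ refl
  root-is-one-of (inj₁ refl) (inj₂ refl) (inj₂ refl) b≢d = contradiction refl b≢d
  root-is-one-of (inj₂ refl) (inj₁ refl) (inj₁ refl) b≢d = contradiction refl b≢d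

  parent : Fin n → Fin n
  parent v = ends G (edge (c v)) (other (side (c v)))

  climb : Fin n → Fin n
  climb v with nonRoot-or-root v
  ... | inj₁ _ = parent v
  ... | inj₂ _ = v

  climb-nonRoot : ∀ {v} → NonRoot v → climb v ≡ parent v
  climb-nonRoot {v} v-nr with nonRoot-or-root v
  ... | inj₁ _ = refl
  ... | inj₂ v-root = contradiction v-root (nonRoot⇒¬root v-nr)

  climb-root : ∀ {v} → IsRoot v → climb v ≡ v
  climb-root {v} v-root with nonRoot-or-root v
  ... | inj₁ v-nr = contradiction v-root (nonRoot⇒¬root v-nr)
  ... | inj₂ _ = refl

  iterate-root : ∀ {v} → IsRoot v → ∀ k → iterate climb v k ≡ v
  iterate-root v-root = iterate-fixed climb (climb-root v-root)

  Arb : EdgeSet G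
  Arb = ContribArb G u₁ u₂ c

  climbing-walk : ∀ y k → Walk G Arb y (iterate climb y k)
  climbing-walk y zero = []
  climbing-walk y (suc k) with nonRoot-or-root y
  ... | inj₁ y-nr = step (edge (c y)) (y , y-nr , refl) (side (c y)) (tail≡ y y-nr) (climbing-walk (parent y) k)
  ... | inj₂ _ = climbing-walk y k

  ownerEnds : ∀ v i → NonRoot v →
    (ends G (edge (c v)) i ≡ v × ends G (edge (c v)) (other i) ≡ parent v)
    ⊎ (ends G (edge (c v)) i ≡ parent v × ends G (edge (c v)) (other i) ≡ v)
  ownerEnds v i v-nr with ≡-or-≡-other i (side (c v))
  ... | inj₁ refl = inj₁ (tail≡ v v-nr , refl)
  ... | inj₂ refl = inj₂ (refl , trans (cong (ends G (edge (c v))) (other-involutive _)) (tail≡ v v-nr))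

  Arb-invariant : ∀ {A : Set} (f : Fin n → A) → (∀ {v} → NonRoot v → f (parent v) ≡ f v) →
    ∀ {x y} → Walk G Arb x y → f x ≡ f y
  Arb-invariant f f-parent [] = refl
  Arb-invariant f f-parent (step _ (v , v-nr , refl) i refl W) with ownerEnds v i v-nr
  ... | inj₁ (tail , head) =
    trans (cong f tail) (trans (sym (f-parent v-nr)) (trans (cong f (sym head)) (Arb-invariant f f-parent W)))
  ... | inj₂ (tail , head) =
    trans (cong f tail) (trans (f-parent v-nr) (trans (cong f (sym head)) (Arb-invariant f f-parent W)))

  module _ (rank : Fin n → ℕ) (rank-parent : ∀ {v} → NonRoot v → rank v ≡ suc (rank (parent v))) where

    rank-monotone : ∀ {x y} (W : Walk G Arb x y) → Unique (walkEdges G W) → NonRoot x →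
      edge (c x) ∉ walkEdges G W → rank x ≤ rank y
    rank-monotone [] _ _ _ = ≤-refl
    rank-monotone (step _ (v , v-nr , refl) i refl W) unique@(_ ∷ rest) _ own∉ with ownerEnds v i v-nr
    ... | inj₁ (tail , _) = contradiction (here (cong (edge ∘ c) tail)) own∉
    ... | inj₂ (tail , head) = begin
      rank (ends G (edge (c v)) i)         ≡⟨ cong rank tail ⟩
      rank (parent v)                      <⟨ n<1+n _ ⟩
      suc (rank (parent v))                ≡⟨ sym (rank-parent v-nr) ⟩
      rank v                               ≡⟨ cong rank (sym head) ⟩
      rank (ends G (edge (c v)) (other i)) ≤⟨ rank-monotone W rest (subst NonRoot (sym head) v-nr) own∉W ⟩
      _                                    ∎
      where
      open ≤-Reasoning
      own∉W : edge (c (ends G (edge (c v)) (other i))) ∉ walkEdges G W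
      own∉W = Unique[x∷xs]⇒x∉xs unique ∘ subst (_∈ walkEdges G W) (cong (edge ∘ c) head)

    -- A cycle uses the edge of some v; the rest of it is a trail from v to parent v along
    -- which, by rank-monotone, the rank cannot drop.
    rank-forest : Forest G Arb
    rank-forest C = closed (Cycle.walk C) (Cycle.nonempty C) (Cycle.uniqE C)
      where
      no-return : ∀ {v a b} → NonRoot v → a ≡ v → b ≡ parent v → (W : Walk G Arb a b) →
        Unique (walkEdges G W) → edge (c v) ∉ walkEdges G W → ⊥
      no-return {v} v-nr refl refl W unique own∉ =
        1+n≰n (subst (_≤ rank (parent v)) (rank-parent v-nr) (rank-monotone W unique v-nr own∉))

      closed : ∀ {b} (W : Walk G Arb b b) → walkEdges G W ≢ [] → Unique (walkEdges G W) → ⊥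
      closed [] nonempty _ = nonempty refl
      closed (step _ (v , v-nr , refl) i refl W) _ unique@(_ ∷ rest) with ownerEnds v i v-nr
      ... | inj₁ (tail , head) =
        no-return v-nr tail head (reverseʷ W) (subst Unique (sym (edges-reverseʷ W)) (reverse-unique rest))
          (Unique[x∷xs]⇒x∉xs unique ∘ reverse⁻ ∘ subst (_ ∈_) (edges-reverseʷ W))
      ... | inj₂ (tail , head) = no-return v-nr head tail W rest (Unique[x∷xs]⇒x∉xs unique)

  -- Periods are bounded by n so that Cyclic is decidable.
  Periodic : Fin n → Set
  Periodic v = Σ[ d ∈ Fin n ] iterate climb v (suc (toℕ d)) ≡ v

  Cyclic : Fin n → Set
  Cyclic v = NonRoot v × Periodic v

  Acyclic : Set
  Acyclic = ∀ v → ¬ Cyclic v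

  cyclic : ∀ {v d} → NonRoot v → d < n → iterate climb v (suc d) ≡ v → Cyclic v
  cyclic {v} v-nr d<n period =
    v-nr , fromℕ< d<n , subst (λ k → iterate climb v (suc k) ≡ v) (sym (toℕ-fromℕ< d<n)) period

  cyclic? : Decidable Cyclic
  cyclic? v = (¬? (v ≟ u₁) ×-dec ¬? (v ≟ u₂)) ×-dec any? (λ d → iterate climb v (suc (toℕ d)) ≟ v)

  climb-cyclic : ∀ {v} → Cyclic v → Cyclic (climb v)
  climb-cyclic {v} (v-nr , d , period) =
    ¬root⇒nonRoot climb-¬root , d , trans (iterate-sucʳ climb (climb v) (toℕ d)) (cong climb period)
    where
    climb-¬root : ¬ IsRoot (climb v)
    climb-¬root climb-root =
      nonRoot⇒¬root v-nr (subst IsRoot (trans (sym (iterate-root climb-root (toℕ d))) period) climb-root)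

  iterate-cyclic : ∀ {v} → Cyclic v → ∀ k → Cyclic (iterate climb v k)
  iterate-cyclic v-cyc zero = v-cyc
  iterate-cyclic v-cyc (suc k) = iterate-cyclic (climb-cyclic v-cyc) k

  -- Both a and b return to themselves after (da + 1)(db + 1) = M + 1 climbs.
  climb-injective-on-cyclic : ∀ {a b} → Cyclic a → Cyclic b → climb a ≡ climb b → a ≡ b
  climb-injective-on-cyclic {a} {b} (_ , da , period-a) (_ , db , period-b) climb-a≡climb-b = begin
    a                          ≡⟨ sym common-period-a ⟩
    iterate climb (climb a) M  ≡⟨ cong (λ y → iterate climb y M) climb-a≡climb-b ⟩
    iterate climb (climb b) M  ≡⟨ iterate-multiple climb {b} {suc (toℕ db)} period-b (suc (toℕ da)) ⟩
    b                          ∎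
    where
    open ≡-Reasoning
    M : ℕ
    M = toℕ db + toℕ da * suc (toℕ db)
    common-period-a : iterate climb a (suc M) ≡ a
    common-period-a = subst (λ k → iterate climb a k ≡ a) (*-comm (suc (toℕ db)) (suc (toℕ da)))
      (iterate-multiple climb {a} {suc (toℕ da)} period-a (suc (toℕ db)))

  height : ℕ → Fin n → ℕ
  height zero y = 0
  height (suc k) y with nonRoot-or-root y
  ... | inj₁ _ = suc (height k (parent y))
  ... | inj₂ _ = 0

  height-nonRoot : ∀ {y} → NonRoot y → ∀ k → height (suc k) y ≡ suc (height k (parent y))
  height-nonRoot {y} y-nr k with nonRoot-or-root y
  ... | inj₁ _ = refl
  ... | inj₂ y-root = contradiction y-root (nonRoot⇒¬root y-nr)

  height-root : ∀ {y} → IsRoot y → ∀ k → height k y ≡ 0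
  height-root y-root zero = refl
  height-root {y} y-root (suc k) with nonRoot-or-root y
  ... | inj₁ y-nr = contradiction y-root (nonRoot⇒¬root y-nr)
  ... | inj₂ _ = refl

  height-stable : ∀ k y → IsRoot (iterate climb y k) → height (suc k) y ≡ height k y
  height-stable zero y y-root = height-root y-root 1
  height-stable (suc k) y reached = Sum.[ nonRoot-case , root-case ]′ (nonRoot-or-root y)
    where
    open ≡-Reasoning
    root-case : IsRoot y → height (suc (suc k)) y ≡ height (suc k) y
    root-case y-root = trans (height-root y-root (suc (suc k))) (sym (height-root y-root (suc k)))
    nonRoot-case : NonRoot y → height (suc (suc k)) y ≡ height (suc k) y
    nonRoot-case y-nr = begin
      height (suc (suc k)) y          ≡⟨ height-nonRoot y-nr (suc k) ⟩
      suc (height (suc k) (parent y)) ≡⟨ cong suc (height-stable k (parent y) parent-reached) ⟩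
      suc (height k (parent y))       ≡⟨ sym (height-nonRoot y-nr k) ⟩
      height (suc k) y                ∎
      where
      parent-reached : IsRoot (iterate climb (parent y) k)
      parent-reached = subst (λ z → IsRoot (iterate climb z k)) (climb-nonRoot y-nr) reached

  module Rooted (acyclic : Acyclic) where

    bounded-period : ∀ {i d} → i + suc d ≤ n → d < n
    bounded-period {i} {d} bound = ≤-trans (m≤n+m (suc d) i) bound

    reaches-root : ∀ y → IsRoot (iterate climb y n)
    reaches-root y with sequence-repeats (iterate climb y)
    ... | i , d , bound , repeat with nonRoot-or-root (iterate climb y i)
    ... | inj₁ nr = contradiction (cyclic nr (bounded-period bound) period) (acyclic _)
      where
      period : iterate climb (iterate climb y i) (suc d) ≡ iterate climb y i
      period = trans (sym (iterate-+ climb y i (suc d))) (sym repeat)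
    ... | inj₂ reached = subst IsRoot (sym stays) reached
      where
      i≤n : i ≤ n
      i≤n = ≤-trans (m≤n+m i (suc d)) (subst (_≤ n) (+-comm i (suc d)) bound)
      stays : iterate climb y n ≡ iterate climb y i
      stays = begin
        iterate climb y n                         ≡⟨ cong (iterate climb y) (sym (m+[n∸m]≡n i≤n)) ⟩
        iterate climb y (i + (n ∸ i))             ≡⟨ iterate-+ climb y i (n ∸ i) ⟩
        iterate climb (iterate climb y i) (n ∸ i) ≡⟨ iterate-root reached (n ∸ i) ⟩
        iterate climb y i                         ∎
        where open ≡-Reasoning

    no-descending-chain : (s : ℕ → Fin n) → (∀ k → NonRoot (s (suc k))) → (∀ k → climb (s (suc k)) ≡ s k) → ⊥
    no-descending-chain s nonRoot climb-s with sequence-repeats s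
    ... | i , d , bound , repeat = acyclic (s (i + suc d)) (cyclic s-nr (bounded-period bound) period)
      where
      descend : ∀ k j → iterate climb (s (k + j)) k ≡ s j
      descend zero j = refl
      descend (suc k) j = trans (cong (λ y → iterate climb y k) (climb-s (k + j))) (descend k j)
      s-nr : NonRoot (s (i + suc d))
      s-nr = subst (NonRoot ∘ s) (sym (+-suc i d)) (nonRoot (i + d))
      period : iterate climb (s (i + suc d)) (suc d) ≡ s (i + suc d)
      period = subst (λ k → iterate climb (s k) (suc d) ≡ s (i + suc d)) (+-comm (suc d) i)
        (trans (descend (suc d) i) repeat)

    root : Fin n → Fin n
    root y = iterate climb y n

    root-parent : ∀ {v} → NonRoot v → root (parent v) ≡ root v
    root-parent {v} v-nr = begin
      iterate climb (parent v) n ≡⟨ cong (λ y → iterate climb y n) (sym (climb-nonRoot v-nr)) ⟩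
      iterate climb v (suc n)    ≡⟨ iterate-sucʳ climb v n ⟩
      climb (root v)             ≡⟨ climb-root (reaches-root v) ⟩
      root v                     ∎
      where open ≡-Reasoning

    depth : Fin n → ℕ
    depth = height (suc n)

    depth-parent : ∀ {v} → NonRoot v → depth v ≡ suc (depth (parent v))
    depth-parent {v} v-nr =
      trans (height-nonRoot v-nr n) (cong suc (sym (height-stable n (parent v) (reaches-root (parent v)))))

    walk-via-root : ∀ {w x} → root x ≡ root w → Walk G Arb w x
    walk-via-root {w} {x} same-root =
      climbing-walk w n ++ʷ subst (λ r → Walk G Arb r x) same-root (reverseʷ (climbing-walk x n))

-- Contributors with a singleton tail-equivalence class

module Contributor {n m} (G : SignedGraph n m) (u₁ u₂ w₁ w₂ : Fin n) (u₁≢u₂ : u₁ ≢ u₂)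
  (c : Assignment G) (c∈C : InC G u₁ u₂ w₁ w₂ c) where

  open ParentForest G u₁ u₂ c (proj₁ c∈C)

  π : Fin n → Fin n
  π = πc G u₁ u₂ w₁ w₂ c

  π-injective : Injective _≡_ _≡_ π
  π-injective = proj₁ (proj₂ c∈C)

  π-surjective : Surjective _≡_ _≡_ π
  π-surjective = proj₂ (proj₂ c∈C)

  π-u₁ : π u₁ ≡ w₁
  π-u₁ = πc-u₁ {u₁ = u₁} {u₂} c

  π-u₂ : π u₂ ≡ w₂
  π-u₂ = πc-u₂ {u₁ = u₁} {u₂} {w₁} u₁≢u₂ c

  π-backstep : ∀ {v} → NonRoot v → back (c v) ≡ true → π v ≡ v
  π-backstep {v} v-nr b = trans (πc-free c v-nr) (trans (stepHead-backstep (c v) b) (proj₁ c∈C v v-nr))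

  π-adjacency : ∀ {v} → NonRoot v → back (c v) ≡ false → π v ≡ parent v
  π-adjacency {v} v-nr a = trans (πc-free c v-nr) (stepHead-adjacency (c v) a)

  adjacency-climb : ∀ {v} → Cyclic v → back (c v) ≡ false → back (c (climb v)) ≡ false
  adjacency-climb {v} v-cyc@(v-nr , _) a with back (c (climb v)) in b
  ... | false = refl
  ... | true = contradiction (trans (sym a) (trans (cong (back ∘ c) (sym climb-v≡v)) b)) λ ()
    where
    climb-v≡v : climb v ≡ v
    climb-v≡v = π-injective (begin
      π (climb v) ≡⟨ π-backstep (proj₁ (climb-cyclic v-cyc)) b ⟩
      climb v     ≡⟨ climb-nonRoot v-nr ⟩
      parent v    ≡⟨ sym (π-adjacency v-nr a) ⟩
      π v         ∎)
      where open ≡-Reasoning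

  adjacency-iterate : ∀ {v} → Cyclic v → back (c v) ≡ false → ∀ k → back (c (iterate climb v k)) ≡ false
  adjacency-iterate v-cyc a zero = a
  adjacency-iterate v-cyc a (suc k) = adjacency-iterate (climb-cyclic v-cyc) (adjacency-climb v-cyc a) k

  backstep-climb : ∀ {v} → Cyclic v → back (c v) ≡ true → back (c (climb v)) ≡ true
  backstep-climb {v} v-cyc@(_ , d , period) bk with back (c (climb v)) in b
  ... | true = refl
  ... | false = contradiction
    (trans (sym bk) (trans (cong (back ∘ c) (sym period)) (adjacency-iterate (climb-cyclic v-cyc) b (toℕ d)))) λ ()

  -- On every cycle of climb, c takes either only backsteps or only adjacencies; switching
  -- between the two on all cycles gives another element of the tail-equivalence class of c.
  flipped : Assignment G
  flipped v with cyclic? v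
  ... | yes _ = mkStep (edge (c v)) (side (c v)) (not (back (c v)))
  ... | no _ = c v

  flipped-cyclic : ∀ {v} → Cyclic v → flipped v ≡ mkStep (edge (c v)) (side (c v)) (not (back (c v)))
  flipped-cyclic {v} v-cyc with cyclic? v
  ... | yes _ = refl
  ... | no ¬v-cyc = contradiction v-cyc ¬v-cyc

  flipped-acyclic : ∀ {v} → ¬ Cyclic v → flipped v ≡ c v
  flipped-acyclic {v} ¬v-cyc with cyclic? v
  ... | yes v-cyc = contradiction v-cyc ¬v-cyc
  ... | no _ = refl

  flipped-tailEq : TailEq G u₁ u₂ c flipped
  flipped-tailEq v _ with cyclic? v
  ... | yes _ = refl , refl
  ... | no _ = refl , refl

  πᶠ : Fin n → Fin n
  πᶠ = πc G u₁ u₂ w₁ w₂ flipped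

  πᶠ-acyclic : ∀ {v} → ¬ Cyclic v → πᶠ v ≡ π v
  πᶠ-acyclic {v} ¬v-cyc = πc-local v (flipped-acyclic ¬v-cyc)

  πᶠ-backstep : ∀ {v} → Cyclic v → back (c v) ≡ true → πᶠ v ≡ parent v
  πᶠ-backstep {v} v-cyc bk = trans (πc-free flipped (proj₁ v-cyc))
    (trans (cong (stepHead G) (flipped-cyclic v-cyc)) (stepHead-adjacency {G = G} _ (cong not bk)))

  πᶠ-adjacency : ∀ {v} → Cyclic v → back (c v) ≡ false → πᶠ v ≡ v
  πᶠ-adjacency {v} v-cyc@(v-nr , _) a = trans (πc-free flipped v-nr)
    (trans (cong (stepHead G) (flipped-cyclic v-cyc)) (trans (stepHead-backstep {G = G} _ (cong not a)) (proj₁ c∈C v v-nr)))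

  πᶠ-cyclic : ∀ {v} → Cyclic v → Cyclic (πᶠ v)
  πᶠ-cyclic {v} v-cyc with back (c v) in b
  ... | true = subst Cyclic (trans (climb-nonRoot (proj₁ v-cyc)) (sym (πᶠ-backstep v-cyc b))) (climb-cyclic v-cyc)
  ... | false = subst Cyclic (sym (πᶠ-adjacency v-cyc b)) v-cyc

  π-reflects-cyclic : ∀ {y} → Cyclic (π y) → Cyclic y
  π-reflects-cyclic {y} πy-cyc@(πy-nr , d , period) with back (c (π y)) in b
  ... | true = subst Cyclic (π-injective (π-backstep πy-nr b)) πy-cyc
  ... | false = subst Cyclic (π-injective π-pred≡π-y) (iterate-cyclic πy-cyc (toℕ d))
    where
    open ≡-Reasoning
    pred : Fin n
    pred = iterate climb (π y) (toℕ d)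
    π-pred≡π-y : π pred ≡ π y
    π-pred≡π-y = begin
      π pred                            ≡⟨ π-adjacency (proj₁ (iterate-cyclic πy-cyc (toℕ d))) (adjacency-iterate πy-cyc b (toℕ d)) ⟩
      parent pred                       ≡⟨ sym (climb-nonRoot (proj₁ (iterate-cyclic πy-cyc (toℕ d)))) ⟩
      climb pred                        ≡⟨ sym (iterate-sucʳ climb (π y) (toℕ d)) ⟩
      iterate climb (π y) (suc (toℕ d)) ≡⟨ period ⟩
      π y                               ∎

  backstep-adjacency-apart : ∀ {x y} → Cyclic x → Cyclic y → back (c x) ≡ true → back (c y) ≡ false → πᶠ x ≢ πᶠ y
  backstep-adjacency-apart {x} {y} x-cyc y-cyc bx ay πᶠx≡πᶠy =
    contradiction (trans (sym (backstep-climb x-cyc bx)) (trans (cong (back ∘ c) climb-x≡y) ay)) λ ()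
    where
    climb-x≡y : climb x ≡ y
    climb-x≡y = trans (climb-nonRoot (proj₁ x-cyc))
      (trans (sym (πᶠ-backstep x-cyc bx)) (trans πᶠx≡πᶠy (πᶠ-adjacency y-cyc ay)))

  πᶠ-injective-on-cyclic : ∀ {x y} → Cyclic x → Cyclic y → πᶠ x ≡ πᶠ y → x ≡ y
  πᶠ-injective-on-cyclic {x} {y} x-cyc y-cyc eq with back (c x) in bx | back (c y) in by
  ... | true | true = climb-injective-on-cyclic x-cyc y-cyc (begin
    climb x  ≡⟨ climb-nonRoot (proj₁ x-cyc) ⟩
    parent x ≡⟨ sym (πᶠ-backstep x-cyc bx) ⟩
    πᶠ x     ≡⟨ eq ⟩
    πᶠ y     ≡⟨ πᶠ-backstep y-cyc by ⟩
    parent y ≡⟨ sym (climb-nonRoot (proj₁ y-cyc)) ⟩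
    climb y  ∎)
    where open ≡-Reasoning
  ... | false | false = trans (sym (πᶠ-adjacency x-cyc bx)) (trans eq (πᶠ-adjacency y-cyc by))
  ... | true | false = contradiction eq (backstep-adjacency-apart x-cyc y-cyc bx by)
  ... | false | true = contradiction (sym eq) (backstep-adjacency-apart y-cyc x-cyc by bx)

  πᶠ-injective : Injective _≡_ _≡_ πᶠ
  πᶠ-injective {x} {y} eq with cyclic? x | cyclic? y
  ... | yes x-cyc | yes y-cyc = πᶠ-injective-on-cyclic x-cyc y-cyc eq
  ... | yes x-cyc | no ¬y-cyc =
    contradiction (π-reflects-cyclic (subst Cyclic (trans eq (πᶠ-acyclic ¬y-cyc)) (πᶠ-cyclic x-cyc))) ¬y-cyc
  ... | no ¬x-cyc | yes y-cyc =
    contradiction (π-reflects-cyclic (subst Cyclic (trans (sym eq) (πᶠ-acyclic ¬x-cyc)) (πᶠ-cyclic y-cyc))) ¬x-cyc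
  ... | no ¬x-cyc | no ¬y-cyc = π-injective (trans (sym (πᶠ-acyclic ¬x-cyc)) (trans eq (πᶠ-acyclic ¬y-cyc)))

  flipped∈C : InC G u₁ u₂ w₁ w₂ flipped
  flipped∈C = flipped-tail , πᶠ-injective , injective⇒surjective πᶠ-injective
    where
    flipped-tail : ∀ v → NonRoot v → stepTail G (flipped v) ≡ v
    flipped-tail v v-nr with flipped-tailEq v v-nr
    ... | same-edge , same-side = trans (sym (cong₂ (ends G) same-edge same-side)) (proj₁ c∈C v v-nr)

  unique⇒acyclic : (∀ c' → InC G u₁ u₂ w₁ w₂ c' → TailEq G u₁ u₂ c c' → SameAssignment G u₁ u₂ c c') → Acyclic
  unique⇒acyclic unique v v-cyc =
    not-¬ refl (cong back (trans (unique flipped flipped∈C flipped-tailEq v (proj₁ v-cyc)) (flipped-cyclic v-cyc)))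

  module Separation (acyclic : Acyclic) where

    open Rooted acyclic

    Adjacent : Fin n → Set
    Adjacent v = NonRoot v × back (c v) ≡ false

    backstep-preimage : ∀ {x y} → NonRoot x → back (c x) ≡ true → π x ≡ y → ¬ (IsRoot y ⊎ Adjacent y)
    backstep-preimage x-nr bk refl (inj₁ πx-root) =
      nonRoot⇒¬root x-nr (subst IsRoot (π-backstep x-nr bk) πx-root)
    backstep-preimage x-nr bk refl (inj₂ (_ , a)) =
      contradiction (trans (sym bk) (trans (cong (back ∘ c) (sym (π-backstep x-nr bk))) a)) λ ()

    roots-separate : root w₁ ≢ root w₂
    roots-separate same-root = no-descending-chain chain (proj₁ ∘ chain-adjacent) chain-climb
      where
      other-root : Σ[ a ∈ Fin n ] IsRoot a × a ≢ root w₁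
      other-root with reaches-root w₁
      ... | inj₁ r≡u₁ = u₂ , inj₂ refl , λ u₂≡r → u₁≢u₂ (trans (sym r≡u₁) (sym u₂≡r))
      ... | inj₂ r≡u₂ = u₁ , inj₁ refl , λ u₁≡r → u₁≢u₂ (trans u₁≡r r≡u₂)

      a : Fin n
      a = proj₁ other-root

      a≢root-w₁ : a ≢ root w₁
      a≢root-w₁ = proj₂ (proj₂ other-root)

      InTree : Fin n → Set
      InTree y = root y ≡ a × (IsRoot y ⊎ Adjacent y)

      preimage-in-tree : ∀ {x y} → π x ≡ y → InTree y → Adjacent x × root x ≡ a
      preimage-in-tree {x} πx≡y (root-y , y-kind) with nonRoot-or-root x
      ... | inj₂ (inj₁ x≡u₁) =
        contradiction (trans (cong root (trans (sym π-u₁) (trans (cong π (sym x≡u₁)) πx≡y))) root-y) (a≢root-w₁ ∘ sym)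
      ... | inj₂ (inj₂ x≡u₂) =
        contradiction (trans same-root (trans (cong root (trans (sym π-u₂) (trans (cong π (sym x≡u₂)) πx≡y))) root-y))
          (a≢root-w₁ ∘ sym)
      ... | inj₁ x-nr with back (c x) in b
      ...   | true = contradiction y-kind (backstep-preimage x-nr b πx≡y)
      ...   | false = (x-nr , refl) ,
        trans (sym (root-parent x-nr)) (trans (cong root (trans (sym (π-adjacency x-nr b)) πx≡y)) root-y)

      chain : ℕ → Fin n
      chain zero = a
      chain (suc k) = proj₁ (π-surjective (chain k))

      π-chain : ∀ k → π (chain (suc k)) ≡ chain k
      π-chain k = proj₂ (π-surjective (chain k)) refl

      chain-in-tree : ∀ k → InTree (chain k)
      chain-adjacent : ∀ k → Adjacent (chain (suc k))
      chain-in-tree zero = iterate-root (proj₁ (proj₂ other-root)) n , inj₁ (proj₁ (proj₂ other-root))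
      chain-in-tree (suc k) = proj₂ (preimage-in-tree (π-chain k) (chain-in-tree k)) , inj₂ (chain-adjacent k)
      chain-adjacent k = proj₁ (preimage-in-tree (π-chain k) (chain-in-tree k))

      chain-climb : ∀ k → climb (chain (suc k)) ≡ chain k
      chain-climb k with chain-adjacent k
      ... | nr , adj = trans (climb-nonRoot nr) (trans (sym (π-adjacency nr adj)) (π-chain k))

    spanning2Forest : Spanning2Forest G Arb w₁ w₂
    spanning2Forest = record
      { forest = rank-forest depth depth-parent
      ; separated = roots-separate ∘ Arb-invariant root root-parent
      ; covering = λ x → Sum.map walk-via-root walk-via-root
          (root-is-one-of (reaches-root x) (reaches-root w₁) (reaches-root w₂) roots-separate)
      }

contribArb⇒spanning2Forest : ∀ {n m} {G : SignedGraph n m} {u₁ u₂ w₁ w₂ : Fin n} {c : Assignment G} →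
  u₁ ≢ u₂ → InC1 G u₁ u₂ w₁ w₂ c → Spanning2Forest G (ContribArb G u₁ u₂ c) w₁ w₂
contribArb⇒spanning2Forest {G = G} {u₁} {u₂} {w₁} {w₂} {c} u₁≢u₂ (c∈C , unique) =
  Separation.spanning2Forest (unique⇒acyclic unique)
  where open Contributor G u₁ u₂ w₁ w₂ u₁≢u₂ c c∈C

-- Neither w₁ ≢ w₂ nor the absence of a joining edge in the second case is needed.
corollary2p5 : ∀ {n m} (G : SignedGraph n m) (u₁ u₂ w₁ w₂ : Fin n) →
    u₁ ≢ u₂ → w₁ ≢ w₂ →
    ((e : Fin m) → Joins G e w₁ w₂ →
      ((S : Fin m → Set) → Tutte2Arb G u₁ u₂ w₁ w₂ S →
        SpanningTree G (addEdge S e))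
      × ((c : Assignment G) → InC1 G u₁ u₂ w₁ w₂ c →
        SpanningTree G (addEdge (ContribArb G u₁ u₂ c) e)))
    ×
    ((∀ e → ¬ Joins G e w₁ w₂) → (s₁ s₂ : Sign) →
      ((S : Fin m → Set) → Tutte2Arb G u₁ u₂ w₁ w₂ S →
        SpanningTree (extend G w₁ w₂ s₁ s₂) (addNewEdge S))
      × ((c : Assignment G) → InC1 G u₁ u₂ w₁ w₂ c →
        SpanningTree (extend G w₁ w₂ s₁ s₂) (addNewEdge (ContribArb G u₁ u₂ c))))
corollary2p5 G u₁ u₂ w₁ w₂ u₁≢u₂ _ =
  (λ e joins → for-both-arborescences (addEdge-spanningTree joins)) ,
  (λ _ s₁ s₂ → for-both-arborescences addNewEdge-spanningTree)
  where
  for-both-arborescences : ∀ {R : EdgeSet G → Set} → (∀ {T} → Spanning2Forest G T w₁ w₂ → R T) →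
    ((S : EdgeSet G) → Tutte2Arb G u₁ u₂ w₁ w₂ S → R S)
    × ((c : Assignment G) → InC1 G u₁ u₂ w₁ w₂ c → R (ContribArb G u₁ u₂ c))
  for-both-arborescences spanning =
    (λ _ → spanning ∘ tutte2Arb⇒spanning2Forest) , (λ _ → spanning ∘ contribArb⇒spanning2Forest u₁≢u₂)
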